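{- For integers $m_1,m_2\ge 2$, let $G_1$ be the star graph $K_{1,m_1}$ of order $m_1+1$ and $G_2$ the star graph $K_{1,m_2}$ of order $m_2+1$. Then $\mathrm{fix}(G_1*G_2)=m_1m_2+m_1+m_2-3$.
   Context: All graphs are finite and simple. For graphs $G_1,G_2$, the co-normal product $G_1*G_2$ is the graph with vertex set $V(G_1)\times V(G_2)$ in which $(a,b)$ and $(c,d)$ are adjacent if and only if $a$ is adjacent to $c$ in $G_1$ or $b$ is adjacent to $d$ in $G_2$. A set $F\subseteq V(G)$ is a fixing set of $G$ if the only automorphism of $G$ fixing every vertex of $F$ is the identity; $\mathrm{fix}(G)$ is the minimum cardinality of a fixing set. -}

module Defs where

open import Data.Nat using (ℕ; zero; suc; _*_; _≤_)
open import Data.Fin using (Fin; zero; suc)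
open import Data.Fin.Base using (remQuot)
open import Data.Fin.Subset using (Subset; _∈_; ∣_∣)
open import Data.Bool using (Bool; true; false; _∨_)
open import Data.Product using (_×_; proj₁; proj₂; Σ-syntax)
open import Relation.Binary.PropositionalEquality using (_≡_; cong₂)
open import Function.Bundles using (_↔_; Inverse)

record Graph (n : ℕ) : Set where
  field
    adj   : Fin n → Fin n → Bool
    sym   : ∀ u v → adj u v ≡ adj v u
    irrefl : ∀ v → adj v v ≡ false
open Graph public

starAdj : ∀ {m} → Fin (suc m) → Fin (suc m) → Bool
starAdj zero    zero    = false
starAdj zero    (suc _) = true
starAdj (suc _) zero    = true
starAdj (suc _) (suc _) = false

starSym : ∀ {m} (u v : Fin (suc m)) → starAdj u v ≡ starAdj v u
starSym zero    zero    = _≡_.refl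
starSym zero    (suc _) = _≡_.refl
starSym (suc _) zero    = _≡_.refl
starSym (suc _) (suc _) = _≡_.refl

starIrr : ∀ {m} (v : Fin (suc m)) → starAdj v v ≡ false
starIrr zero    = _≡_.refl
starIrr (suc _) = _≡_.refl

Star : (m : ℕ) → Graph (suc m)
Star m = record { adj = starAdj ; sym = starSym ; irrefl = starIrr }

-- Co-normal product: vertex set Fin n₁ × Fin n₂, encoded as Fin (n₁ * n₂) via remQuot
-- (a bijection; remQuot i = (first coordinate, second coordinate)).
conormalAdj : ∀ {n₁ n₂} → Graph n₁ → Graph n₂ → Fin (n₁ * n₂) → Fin (n₁ * n₂) → Bool
conormalAdj {n₁} {n₂} G₁ G₂ x y =
  adj G₁ (proj₁ (remQuot {n₁} n₂ x)) (proj₁ (remQuot {n₁} n₂ y))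
  ∨ adj G₂ (proj₂ (remQuot {n₁} n₂ x)) (proj₂ (remQuot {n₁} n₂ y))

-- Automorphism: a bijection of the vertex set preserving adjacency (both directions,
-- since adj is Bool-valued equality expresses iff).
record Automorphism {n : ℕ} (G : Graph n) : Set where
  field
    perm     : Fin n ↔ Fin n
    preserve : ∀ u v → adj G (Inverse.to perm u) (Inverse.to perm v) ≡ adj G u v
open Automorphism public

IsFixingSet : ∀ {n} → Graph n → Subset n → Set
IsFixingSet {n} G F =
  (σ : Automorphism G) → (∀ v → v ∈ F → Inverse.to (perm σ) v ≡ v) →
  ∀ v → Inverse.to (perm σ) v ≡ v

FixNumber : ∀ {n} → Graph n → ℕ → Set
FixNumber {n} G k =
  (Σ[ F ∈ Subset n ] (IsFixingSet G F × ∣ F ∣ ≡ k))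
  × (∀ (F : Subset n) → IsFixingSet G F → k ≤ ∣ F ∣)

conormalSym : ∀ {n₁ n₂} (G₁ : Graph n₁) (G₂ : Graph n₂) u v →
  conormalAdj G₁ G₂ u v ≡ conormalAdj G₁ G₂ v u
conormalSym {n₁} {n₂} G₁ G₂ u v
  = cong₂ _∨_ (sym G₁ (proj₁ (remQuot {n₁} n₂ u)) (proj₁ (remQuot {n₁} n₂ v)))
               (sym G₂ (proj₂ (remQuot {n₁} n₂ u)) (proj₂ (remQuot {n₁} n₂ v)))

conormalIrr : ∀ {n₁ n₂} (G₁ : Graph n₁) (G₂ : Graph n₂) v → conormalAdj G₁ G₂ v v ≡ false
conormalIrr {n₁} {n₂} G₁ G₂ v
  = cong₂ _∨_ (irrefl G₁ (proj₁ (remQuot {n₁} n₂ v))) (irrefl G₂ (proj₂ (remQuot {n₁} n₂ v)))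

Conormal : ∀ {n₁ n₂} → Graph n₁ → Graph n₂ → Graph (n₁ * n₂)
Conormal G₁ G₂ = record { adj = conormalAdj G₁ G₂ ; sym = conormalSym G₁ G₂ ; irrefl = conormalIrr G₁ G₂ }

module Submission where

-- A vertex (x , y) of the product has one of four types (x centre or leaf,
-- y centre or leaf), and its neighbourhood depends only on its type.  Two
-- distinct vertices with equal neighbourhoods (twins) are swapped by an
-- automorphism, so a fixing set misses at most one vertex of each type:
-- every fixing set has at least N ∸ 4 elements, N = (m₁ + 1)(m₂ + 1).
-- Conversely, choose one representative of each type (built from the centre
-- and the first leaf of each star) and let F be all the other vertices.
-- When m₁, m₂ ≥ 2 the three vertices (0,2), (2,0), (2,2) lie in F, and
-- their adjacencies to a vertex determine its type; hence two
-- representatives that are adjacent to the same elements of F coincide,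
-- which forces every automorphism fixing F to be the identity.

open import Data.Nat using (ℕ; zero; suc; _+_; _*_; _∸_; _≤_; z≤n; s≤s)
open import Data.Nat.Properties
  using (module ≤-Reasoning; ≤-trans; ≤-reflexive; ≤-antisym; +-suc; +-comm; +-monoʳ-≤; ∸-monoʳ-≤; m≤n+o⇒m∸n≤o)
open import Data.Nat.Tactic.RingSolver using (solve-∀)
open import Data.Fin using (Fin; zero; suc; _≟_)
open import Data.Fin.Base using (remQuot; combine)
open import Data.Fin.Properties
  using (0≢1+n; suc-injective; remQuot-combine; combine-remQuot; combine-injectiveˡ; combine-injectiveʳ)
import Data.Fin.Permutation as Permutation
import Data.Fin.Permutation.Components as PermutationComponents
open import Data.Fin.Subset using (Subset; _∈_; _∉_; ∣_∣; ∁; ⊤; ⊥; _-_)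
open import Data.Fin.Subset.Properties
  using (_∈?_; drop-there; ∈⊤; ∣⊤∣≡n; ∣⊥∣≡0; x∈p⇒∣p-x∣<∣p∣; x∈p∧x≢y⇒x∈p-y;
         x∉p⇒x∈∁p; x∉∁p⇒x∈p; ∣∁p∣≡n∸∣p∣)
open import Data.Bool using (Bool; true; false; _∨_)
open import Data.Vec using ([]; _∷_; tabulate)
open import Data.Vec.Properties using (lookup∘tabulate; []=⇒lookup; lookup⇒[]=)
open import Data.Product using (_×_; _,_; proj₁; proj₂; uncurry; map)
open import Data.Empty using (⊥-elim)
open import Relation.Nullary using (Dec; yes; no; does)
open import Relation.Binary.PropositionalEquality
open import Function using (_∘_)
open import Function.Bundles using (Inverse; Injection)
open import Function.Properties.Inverse using (↔⇒↣)
open import Defs hiding (sym)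

Twins : ∀ {n} → Graph n → Fin n → Fin n → Set
Twins G u v = ∀ w → adj G u w ≡ adj G v w

module TwinSwap {n} (G : Graph n) {i j : Fin n} (i~j : Twins G i j) where

  swap : Fin n → Fin n
  swap = PermutationComponents.transpose i j

  swap-twin : ∀ u → Twins G (swap u) u
  swap-twin u with u ≟ i
  ... | yes refl = λ w → sym (i~j w)
  ... | no _ with u ≟ j
  ...   | yes refl = i~j
  ...   | no _ = λ w → refl

  swap-preserves : ∀ u v → adj G (swap u) (swap v) ≡ adj G u v
  swap-preserves u v = begin
    adj G (swap u) (swap v)  ≡⟨ swap-twin u (swap v) ⟩
    adj G u (swap v)         ≡⟨ Graph.sym G u (swap v) ⟩
    adj G (swap v) u         ≡⟨ swap-twin v u ⟩
    adj G v u                ≡⟨ Graph.sym G v u ⟩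
    adj G u v                ∎
    where open ≡-Reasoning

  swap-i : swap i ≡ j
  swap-i with i ≟ i
  ... | yes _ = refl
  ... | no i≢i = ⊥-elim (i≢i refl)

  swap-other : ∀ v → v ≢ i → v ≢ j → swap v ≡ v
  swap-other v v≢i v≢j with v ≟ i
  ... | yes v≡i = ⊥-elim (v≢i v≡i)
  ... | no _ with v ≟ j
  ...   | yes v≡j = ⊥-elim (v≢j v≡j)
  ...   | no _ = refl

  twinSwap : Automorphism G
  twinSwap = record { perm = Permutation.transpose i j ; preserve = swap-preserves }

act : ∀ {n} {G : Graph n} → Automorphism G → Fin n → Fin n
act σ = Inverse.to (perm σ)

module _ {n} {G : Graph n} {F : Subset n} where

  -- Two twins outside a fixing set are equal: their transposition fixes F.
  twins-outside-fixingSet : IsFixingSet G F → ∀ {i j} → i ∉ F → j ∉ F → Twins G i j → i ≡ j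
  twins-outside-fixingSet fixing {i} {j} i∉F j∉F i~j =
    trans (sym (fixing twinSwap swap-fixes-F i)) swap-i
    where
    open TwinSwap G i~j
    swap-fixes-F : ∀ v → v ∈ F → swap v ≡ v
    swap-fixes-F v v∈F = swap-other v (λ { refl → i∉F v∈F }) (λ { refl → j∉F v∈F })

  -- If the vertices outside F are told apart by their adjacencies to F, then
  -- F is a fixing set: an automorphism fixing F keeps these adjacencies.
  AdjacencyDetermined : Set
  AdjacencyDetermined =
    ∀ u v → u ∉ F → v ∉ F → (∀ w → w ∈ F → adj G u w ≡ adj G v w) → u ≡ v

  adjacencyDetermined⇒fixing : AdjacencyDetermined → IsFixingSet G F
  adjacencyDetermined⇒fixing determined σ fixes v with v ∈? F
  ... | yes v∈F = fixes v v∈F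
  ... | no v∉F with act σ v ∈? F
  ...   | yes σv∈F = Injection.injective (↔⇒↣ (perm σ)) (fixes (act σ v) σv∈F)
  ...   | no σv∉F = determined (act σ v) v σv∉F v∉F same-adjacency
    where
    same-adjacency : ∀ w → w ∈ F → adj G (act σ v) w ≡ adj G v w
    same-adjacency w w∈F = trans (cong (adj G (act σ v)) (sym (fixes w w∈F))) (preserve σ v w)

InjectiveOutside : ∀ {n k} → Subset n → (Fin n → Fin k) → Set
InjectiveOutside F c = ∀ i j → i ∉ F → j ∉ F → c i ≡ c j → i ≡ j

injectiveOutside-tail : ∀ {n k} b (F : Subset n) (c : Fin (suc n) → Fin k) →
  InjectiveOutside (b ∷ F) c → InjectiveOutside F (c ∘ suc)
injectiveOutside-tail b F c injective i j i∉F j∉F e =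
  suc-injective (injective (suc i) (suc j) (i∉F ∘ drop-there) (j∉F ∘ drop-there) e)

-- Induction on F; a point
-- outside F uses up the element it is sent to, which is removed from U.
injectiveOutside⇒≤ : ∀ {n k} (F : Subset n) (U : Subset k) (c : Fin n → Fin k) →
  (∀ i → i ∉ F → c i ∈ U) → InjectiveOutside F c → n ≤ ∣ F ∣ + ∣ U ∣
injectiveOutside⇒≤ [] U c into injective = z≤n
injectiveOutside⇒≤ (true ∷ F) U c into injective =
  s≤s (injectiveOutside⇒≤ F U (c ∘ suc) (λ i i∉F → into (suc i) (i∉F ∘ drop-there))
        (injectiveOutside-tail true F c injective))
injectiveOutside⇒≤ {suc n} (false ∷ F) U c into injective = begin
  suc n                         ≤⟨ s≤s (injectiveOutside⇒≤ F (U - c zero) (c ∘ suc) into′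
                                         (injectiveOutside-tail false F c injective)) ⟩
  suc (∣ F ∣ + ∣ U - c zero ∣)  ≡⟨ sym (+-suc ∣ F ∣ ∣ U - c zero ∣) ⟩
  ∣ F ∣ + suc ∣ U - c zero ∣    ≤⟨ +-monoʳ-≤ ∣ F ∣ (x∈p⇒∣p-x∣<∣p∣ (into zero λ ())) ⟩
  ∣ F ∣ + ∣ U ∣                 ∎
  where
  open ≤-Reasoning
  into′ : ∀ i → i ∉ F → c (suc i) ∈ U - c zero
  into′ i i∉F = x∈p∧x≢y⇒x∈p-y (into (suc i) (i∉F ∘ drop-there))
                  (λ e → 0≢1+n (injective zero (suc i) (λ ()) (i∉F ∘ drop-there) (sym e)))

injection⇒≤ : ∀ {k n} (U : Subset n) (r : Fin k → Fin n) →
  (∀ s t → r s ≡ r t → s ≡ t) → (∀ t → r t ∈ U) → k ≤ ∣ U ∣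
injection⇒≤ {k} U r injective into = subst (k ≤_) (cong (_+ ∣ U ∣) (∣⊥∣≡0 k))
  (injectiveOutside⇒≤ (⊥ {k}) U r (λ t _ → into t) (λ s t _ _ → injective s t))

-- If c : Fin n → Fin k takes equal values only on twins, then a fixing set
-- misses at most one vertex of each class, so it has at least n ∸ k elements;
-- a fixing set of that size therefore realises the fixing number.
module _ {n k} (G : Graph n) (c : Fin n → Fin k) (classes-twins : ∀ u v → c u ≡ c v → Twins G u v) where

  fixingSet-lowerBound : ∀ F → IsFixingSet G F → n ∸ k ≤ ∣ F ∣
  fixingSet-lowerBound F fixing = m≤n+o⇒m∸n≤o n k (begin
    n                  ≤⟨ injectiveOutside⇒≤ F ⊤ c (λ _ _ → ∈⊤) injective ⟩
    ∣ F ∣ + ∣ ⊤ {k} ∣  ≡⟨ cong (∣ F ∣ +_) (∣⊤∣≡n k) ⟩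
    ∣ F ∣ + k          ≡⟨ +-comm ∣ F ∣ k ⟩
    k + ∣ F ∣          ∎)
    where
    open ≤-Reasoning
    injective : InjectiveOutside F c
    injective u v u∉F v∉F e = twins-outside-fixingSet fixing u∉F v∉F (classes-twins u v e)

  fixNumber-from-twinClasses : ∀ F → IsFixingSet G F → ∣ F ∣ ≤ n ∸ k → FixNumber G (n ∸ k)
  fixNumber-from-twinClasses F fixing small =
    (F , fixing , ≤-antisym small (fixingSet-lowerBound F fixing)) , fixingSet-lowerBound

select : ∀ {n} {P : Fin n → Set} → (∀ v → Dec (P v)) → Subset n
select P? = tabulate (λ v → does (P? v))

module _ {n} {P : Fin n → Set} (P? : ∀ v → Dec (P v)) where

  select⁺ : ∀ {v} → P v → v ∈ select P?
  select⁺ {v} Pv with P? v in eq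
  ... | yes _ = lookup⇒[]= v (select P?) (trans (lookup∘tabulate (λ u → does (P? u)) v) (cong does eq))
  ... | no ¬Pv = ⊥-elim (¬Pv Pv)

  select⁻ : ∀ {v} → v ∈ select P? → P v
  select⁻ {v} v∈ with P? v | trans (sym (lookup∘tabulate (λ u → does (P? u)) v)) ([]=⇒lookup v∈)
  ... | yes Pv | _ = Pv
  ... | no _ | ()

kind : ∀ {m} → Fin (suc m) → Fin 2
kind zero    = zero
kind (suc _) = suc zero

starAdj-kind : ∀ {m} (x x′ : Fin (suc m)) → kind x ≡ kind x′ → ∀ y → starAdj x y ≡ starAdj x′ y
starAdj-kind zero    zero     _ y = refl
starAdj-kind (suc _) (suc _)  _ zero = refl
starAdj-kind (suc _) (suc _)  _ (suc _) = refl

kindRep : ∀ {m} → Fin 2 → Fin (suc (suc m))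
kindRep zero       = zero
kindRep (suc zero) = suc zero

kind-kindRep : ∀ {m} (t : Fin 2) → kind (kindRep {m} t) ≡ t
kind-kindRep zero       = refl
kind-kindRep (suc zero) = refl

module StarProduct (m₁ m₂ : ℕ) where

  N : ℕ
  N = suc m₁ * suc m₂

  G : Graph N
  G = Conormal (Star m₁) (Star m₂)

  Pair : Set
  Pair = Fin (suc m₁) × Fin (suc m₂)

  coords : Fin N → Pair
  coords = remQuot (suc m₂)

  vertex : Pair → Fin N
  vertex = uncurry combine

  coords-vertex : ∀ p → coords (vertex p) ≡ p
  coords-vertex (x , y) = remQuot-combine x y

  -- Adjacency of pairs; adj G u v is adjP (coords u) (coords v) by definition.
  adjP : Pair → Pair → Bool
  adjP (x , y) (x′ , y′) = starAdj x x′ ∨ starAdj y y′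

  adj-vertex : ∀ v p → adj G v (vertex p) ≡ adjP (coords v) p
  adj-vertex v p = cong (adjP (coords v)) (coords-vertex p)

  typeP : Pair → Fin 4
  typeP (x , y) = combine (kind x) (kind y)

  type : Fin N → Fin 4
  type v = typeP (coords v)

  typeP-twins : ∀ p q → typeP p ≡ typeP q → ∀ r → adjP p r ≡ adjP q r
  typeP-twins (x , y) (x′ , y′) same (z , z′) = cong₂ _∨_
    (starAdj-kind x x′ (combine-injectiveˡ (kind x) (kind y) (kind x′) (kind y′) same) z)
    (starAdj-kind y y′ (combine-injectiveʳ (kind x) (kind y) (kind x′) (kind y′) same) z′)

  type-twins : ∀ u v → type u ≡ type v → Twins G u v
  type-twins u v same w = typeP-twins (coords u) (coords v) same (coords w)

-- Representatives and witnesses need m₁, m₂ ≥ 2: write m₁ = a + 2, m₂ = b + 2.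
module Representatives (a b : ℕ) where
  open StarProduct (suc (suc a)) (suc (suc b))

  kinds : Fin 4 → Fin 2 × Fin 2
  kinds = remQuot {2} 2

  repP : Fin 4 → Pair
  repP t = map kindRep kindRep (kinds t)

  rep : Fin 4 → Fin N
  rep t = vertex (repP t)

  typeP-repP : ∀ t → typeP (repP t) ≡ t
  typeP-repP t = begin
    typeP (repP t)                               ≡⟨ cong₂ combine (kind-kindRep (proj₁ (kinds t)))
                                                                  (kind-kindRep (proj₂ (kinds t))) ⟩
    combine (proj₁ (kinds t)) (proj₂ (kinds t))  ≡⟨ combine-remQuot {2} 2 t ⟩
    t                                            ∎
    where open ≡-Reasoning

  type-rep : ∀ t → type (rep t) ≡ t
  type-rep t = trans (cong typeP (coords-vertex (repP t))) (typeP-repP t)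

  IsRep : Fin N → Set
  IsRep v = v ≡ rep (type v)

  isRep? : ∀ v → Dec (IsRep v)
  isRep? v = v ≟ rep (type v)

  Reps : Subset N
  Reps = select isRep?

  F : Subset N
  F = ∁ Reps

  ∉F⇒IsRep : ∀ v → v ∉ F → IsRep v
  ∉F⇒IsRep v v∉F = select⁻ isRep? (x∉∁p⇒x∈p v∉F)

  rep∈Reps : ∀ t → rep t ∈ Reps
  rep∈Reps t = select⁺ isRep? (cong rep (sym (type-rep t)))

  four≤∣Reps∣ : 4 ≤ ∣ Reps ∣
  four≤∣Reps∣ = injection⇒≤ Reps rep
    (λ s t e → trans (sym (type-rep s)) (trans (cong type e) (type-rep t))) rep∈Reps

  ∣F∣≤N∸4 : ∣ F ∣ ≤ N ∸ 4
  ∣F∣≤N∸4 = ≤-trans (≤-reflexive (∣∁p∣≡n∸∣p∣ Reps)) (∸-monoʳ-≤ N four≤∣Reps∣)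

  two₁ : Fin (suc (suc (suc a)))
  two₁ = suc (suc zero)

  two₂ : Fin (suc (suc (suc b)))
  two₂ = suc (suc zero)

  w₁ w₂ w₃ : Pair
  w₁ = zero , two₂
  w₂ = two₁ , zero
  w₃ = two₁ , two₂

  Signature : Set
  Signature = Bool × Bool × Bool

  signatureP : Pair → Signature
  signatureP p = adjP p w₁ , adjP p w₂ , adjP p w₃

  signature : Fin N → Signature
  signature v = adj G v (vertex w₁) , adj G v (vertex w₂) , adj G v (vertex w₃)

  signature-coords : ∀ v → signature v ≡ signatureP (coords v)
  signature-coords v =
    cong₂ _,_ (adj-vertex v w₁) (cong₂ _,_ (adj-vertex v w₂) (adj-vertex v w₃))

  decode : Signature → Fin 4
  decode (false , _ , _)        = typeP (zero , suc zero)
  decode (true , false , _)     = typeP (suc zero , zero)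
  decode (true , true , false)  = typeP (suc zero , suc zero)
  decode (true , true , true)   = typeP (zero , zero)

  typeP-signature : ∀ p → typeP p ≡ decode (signatureP p)
  typeP-signature (zero , zero) = refl
  typeP-signature (zero , suc _) = refl
  typeP-signature (suc _ , zero) = refl
  typeP-signature (suc _ , suc _) = refl

  type-signature : ∀ v → type v ≡ decode (signature v)
  type-signature v = trans (typeP-signature (coords v)) (cong decode (sym (signature-coords v)))

  vertex∈F : ∀ p → p ≢ repP (typeP p) → vertex p ∈ F
  vertex∈F p p≢rep = x∉p⇒x∈∁p (λ v∈Reps → p≢rep (begin
    p                                 ≡⟨ sym (coords-vertex p) ⟩
    coords (vertex p)                 ≡⟨ cong coords (select⁻ isRep? v∈Reps) ⟩
    coords (rep (type (vertex p)))    ≡⟨ coords-vertex _ ⟩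
    repP (typeP (coords (vertex p)))  ≡⟨ cong (repP ∘ typeP) (coords-vertex p) ⟩
    repP (typeP p)                    ∎))
    where open ≡-Reasoning

  -- Representatives are told apart by their adjacencies to the witnesses,
  -- which lie in F; hence F is a fixing set.
  reps-adjacencyDetermined : AdjacencyDetermined {G = G} {F = F}
  reps-adjacencyDetermined u v u∉F v∉F agree = begin
    u                           ≡⟨ ∉F⇒IsRep u u∉F ⟩
    rep (type u)                ≡⟨ cong rep (type-signature u) ⟩
    rep (decode (signature u))  ≡⟨ cong (rep ∘ decode) same-signature ⟩
    rep (decode (signature v))  ≡⟨ cong rep (sym (type-signature v)) ⟩
    rep (type v)                ≡⟨ sym (∉F⇒IsRep v v∉F) ⟩
    v                           ∎
    where
    open ≡-Reasoning
    agree-at : ∀ w → w ≢ repP (typeP w) → adj G u (vertex w) ≡ adj G v (vertex w)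
    agree-at w w≢rep = agree (vertex w) (vertex∈F w w≢rep)
    same-signature : signature u ≡ signature v
    same-signature = cong₂ _,_ (agree-at w₁ (λ ())) (cong₂ _,_ (agree-at w₂ (λ ())) (agree-at w₃ (λ ())))

  F-fixing : IsFixingSet G F
  F-fixing = adjacencyDetermined⇒fixing reps-adjacencyDetermined

  fixNumber : FixNumber G (N ∸ 4)
  fixNumber = fixNumber-from-twinClasses G type type-twins F F-fixing ∣F∣≤N∸4

order∸4 : ∀ m₁ m₂ → suc m₁ * suc m₂ ∸ 4 ≡ m₁ * m₂ + m₁ + m₂ ∸ 3
order∸4 m₁ m₂ = cong (_∸ 4) (order m₁ m₂)
  where
  order : ∀ m₁ m₂ → suc m₁ * suc m₂ ≡ suc (m₁ * m₂ + m₁ + m₂)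
  order = solve-∀

theorem3p16 : (m₁ m₂ : ℕ) → 2 ≤ m₁ → 2 ≤ m₂ →
    FixNumber (Conormal (Star m₁) (Star m₂)) (m₁ * m₂ + m₁ + m₂ ∸ 3)
theorem3p16 (suc (suc a)) (suc (suc b)) (s≤s (s≤s z≤n)) (s≤s (s≤s z≤n)) =
  subst (FixNumber (Conormal (Star (suc (suc a))) (Star (suc (suc b)))))
        (order∸4 (suc (suc a)) (suc (suc b)))
        (Representatives.fixNumber a b)
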